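{- Let $q\geq 3$ and let $d\geq 4$ be an even integer. Then $\chi(T_q,d)\geq q+1$.
   Context: $T_q$ is the infinite $q$-regular tree, viewed as a metric space on its vertex set where each edge has length $1$ (combinatorial graph distance). $\chi(T_q,d)$ is the minimal number of colors needed to color the vertices of $T_q$ so that any two vertices at distance exactly $d$ receive different colors. -}

module Defs where

open import Data.Nat using (ℕ; zero; suc; _<_)
open import Data.Fin using (Fin; _≟_)
open import Data.List using (List; []; _∷_)
open import Data.Unit using (⊤)
open import Data.Product using (Σ; Σ-syntax; _×_; proj₁)
open import Data.Sum using (_⊎_)
open import Relation.Nullary using (¬_)
open import Relation.Nullary.Decidable using (False)
open import Relation.Binary.PropositionalEquality using (_≡_)

-- The infinite q-regular tree T_q, realised as the Cayley graph of the free
-- product of q copies of Z/2: vertices are reduced words over the alphabet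
-- Fin q (no two consecutive letters equal); two vertices are adjacent iff one
-- word is obtained from the other by prepending one letter.  Every vertex has
-- exactly q neighbours and the graph is a tree.

Reduced : {q : ℕ} → List (Fin q) → Set
Reduced []            = ⊤
Reduced (x ∷ [])      = ⊤
Reduced (x ∷ y ∷ xs)  = False (x ≟ y) × Reduced (y ∷ xs)

Vertex : ℕ → Set
Vertex q = Σ (List (Fin q)) Reduced

word : {q : ℕ} → Vertex q → List (Fin q)
word = proj₁

Adj : {q : ℕ} → Vertex q → Vertex q → Set
Adj {q} u v = (Σ[ a ∈ Fin q ] word v ≡ a ∷ word u)
            ⊎ (Σ[ a ∈ Fin q ] word u ≡ a ∷ word v)

data Walk {q : ℕ} : Vertex q → Vertex q → ℕ → Set where
  nil  : {u : Vertex q} → Walk u u zero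
  step : {u v w : Vertex q} {n : ℕ} → Adj u v → Walk v w n → Walk u w (suc n)

Dist : {q : ℕ} → Vertex q → Vertex q → ℕ → Set
Dist u v n = Walk u v n × (∀ m → m < n → ¬ Walk u v m)

DistColouring : (q d k : ℕ) → (Vertex q → Fin k) → Set
DistColouring q d k c = ∀ u v → Dist u v d → ¬ (c u ≡ c v)

module Submission where

-- Write d = 2(n + 2) and suppose only k ≤ q colours are used.
-- A vertex of T_q is described by its root-first path (the reversed word).
-- If two vertices have root-first paths p ++ s and p ++ t, where s and t
-- start with different letters, their distance is |s| + |t|: a walk of that
-- length goes up to the branching vertex p and down again, and no shorter
-- walk exists because the "tree distance" δ of root-first paths changes by at
-- most one along every edge.
-- Fix the vertex C with path 2 0 2 0 … of length n.  For two distinct letters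
-- e, f ≠ 2 let W(e,f) = e 2 f e f … (length n + 2) and, for each of the q − 1
-- letters a ≠ f, P(a) = e f a f e f … (length n + 4).  Then C, W(e,f) and the
-- P(a) are pairwise at distance d, except possibly C and W(e,f).  With at most
-- q colours, pigeonhole forces colour(C) = colour(W(e,f)).  Applying this to
-- (e,f) = (0,1) and (1,0) gives W(0,1) and W(1,0) the same colour, although
-- they lie at distance (n + 2) + (n + 2) = d: a contradiction.

open import Defs
open import Data.Nat using (ℕ; zero; suc; _≤_; _<_; _+_; _*_; z≤n; s≤s)
open import Data.Nat.Properties
  using (≤-refl; ≤-trans; n≤1+n; <-irrefl; ≰⇒>; +-comm; +-identityʳ)
open import Data.Nat.Tactic.RingSolver using (solve-∀)
open import Data.Fin using (Fin; zero; suc; _≟_; punchIn) renaming (_<_ to _<ᶠ_)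
open import Data.Fin.Properties using (pigeonhole; <⇒≢; punchInᵢ≢i; punchIn-injective)
open import Data.List using (List; []; _∷_; _++_; _∷ʳ_; _ʳ++_; reverse; length)
open import Data.List.Properties
  using (length-++; unfold-reverse; reverse-++; reverse-involutive; length-reverse)
open import Data.Unit using (⊤; tt)
open import Data.Empty using (⊥; ⊥-elim)
open import Data.Product using (∃-syntax; _×_; _,_; proj₂)
open import Data.Sum using (inj₁; inj₂)
open import Function using (_∘′_)
open import Relation.Nullary using (¬_; yes; no)
open import Relation.Nullary.Decidable using (False; toWitnessFalse; fromWitnessFalse)
open import Relation.Binary.PropositionalEquality
  using (_≡_; _≢_; ≢-sym; refl; sym; trans; cong; cong₂; subst; module ≡-Reasoning)

module _ {q : ℕ} where

  reduced-irrelevant : (xs : List (Fin q)) (r r' : Reduced xs) → r ≡ r'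
  reduced-irrelevant []           _ _ = refl
  reduced-irrelevant (x ∷ [])     _ _ = refl
  reduced-irrelevant (x ∷ y ∷ xs) (r , rs) (r' , rs') =
    cong₂ _,_ (false-irrelevant r r') (reduced-irrelevant (y ∷ xs) rs rs')
    where
      false-irrelevant : (a b : False (x ≟ y)) → a ≡ b
      false-irrelevant a b with x ≟ y
      ... | yes _ = ⊥-elim a
      ... | no  _ = refl

  vertex-≡ : {u v : Vertex q} → word u ≡ word v → u ≡ v
  vertex-≡ {w , r} {.w , r'} refl = cong (w ,_) (reduced-irrelevant w r r')

  reduced-suffix : (xs ys : List (Fin q)) → Reduced (xs ++ ys) → Reduced ys
  reduced-suffix []           ys       r = r
  reduced-suffix (x ∷ [])     []       r = tt
  reduced-suffix (x ∷ [])     (y ∷ ys) r = proj₂ r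
  reduced-suffix (x ∷ x' ∷ xs) ys      r = reduced-suffix (x' ∷ xs) ys (proj₂ r)

  cons-reduced : {x y : Fin q} {xs : List (Fin q)} → x ≢ y → Reduced (y ∷ xs) → Reduced (x ∷ y ∷ xs)
  cons-reduced x≢y r = fromWitnessFalse x≢y , r

  reduced-reverse : (xs : List (Fin q)) → Reduced xs → Reduced (reverse xs)
  reduced-reverse []       _ = tt
  reduced-reverse (x ∷ xs) r = go [] x xs r tt
    where
      -- Letters of x ∷ xs are moved one by one onto the accumulator; x is the
      -- letter at the junction, so both x ∷ xs and x ∷ acc are reduced.
      go : (acc : List (Fin q)) (x : Fin q) (xs : List (Fin q))
         → Reduced (x ∷ xs) → Reduced (x ∷ acc) → Reduced (xs ʳ++ (x ∷ acc))
      go acc x []       _        racc = racc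
      go acc x (y ∷ ys) (x≢y , r) racc =
        go (x ∷ acc) y ys r (cons-reduced (≢-sym (toWitnessFalse x≢y)) racc)

  _++ʷ_ : {u v w : Vertex q} {m n : ℕ} → Walk u v m → Walk v w n → Walk u w (m + n)
  nil       ++ʷ W = W
  step a V  ++ʷ W = step a (V ++ʷ W)

  adj-sym : {u v : Vertex q} → Adj u v → Adj v u
  adj-sym (inj₁ e) = inj₂ e
  adj-sym (inj₂ e) = inj₁ e

  reverseʷ : {u v : Vertex q} {n : ℕ} → Walk u v n → Walk v u n
  reverseʷ nil = nil
  reverseʷ {u} {n = suc n} (step {v = v} a W) =
    subst (Walk _ _) (+-comm n 1) (reverseʷ W ++ʷ step (adj-sym {u} {v} a) nil)

  ascend : (r : List (Fin q)) (u v : Vertex q) → word u ≡ r ++ word v → Walk u v (length r)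
  ascend []      u v e = subst (λ x → Walk u x 0) (vertex-≡ e) nil
  ascend (a ∷ r) u v e = step (inj₂ (a , e)) (ascend r parent v refl)
    where
      parent : Vertex q
      parent = r ++ word v , reduced-suffix (a ∷ []) (r ++ word v) (subst Reduced e (proj₂ u))

  walk-potential : (φ : Vertex q → ℕ) → (∀ {u v} → Adj u v → φ u ≤ suc (φ v))
                 → {u v : Vertex q} {n : ℕ} → Walk u v n → φ u ≤ n + φ v
  walk-potential φ lip nil        = ≤-refl
  walk-potential φ lip (step a W) = ≤-trans (lip a) (s≤s (walk-potential φ lip W))

  δ : List (Fin q) → List (Fin q) → ℕ
  δ []       t        = length t
  δ (x ∷ s)  []       = suc (length s)
  δ (x ∷ s)  (y ∷ t)  with x ≟ y
  ... | yes _ = δ s t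
  ... | no  _ = suc (length s) + suc (length t)

  δ-self : (s : List (Fin q)) → δ s s ≡ 0
  δ-self []      = refl
  δ-self (x ∷ s) with x ≟ x
  ... | yes _   = δ-self s
  ... | no  x≢x = ⊥-elim (x≢x refl)

  δ-common-prefix : (p s t : List (Fin q)) → δ (p ++ s) (p ++ t) ≡ δ s t
  δ-common-prefix []      s t = refl
  δ-common-prefix (x ∷ p) s t with x ≟ x
  ... | yes _   = δ-common-prefix p s t
  ... | no  x≢x = ⊥-elim (x≢x refl)

  Diverge : List (Fin q) → List (Fin q) → Set
  Diverge (x ∷ s) (y ∷ t) = x ≢ y
  Diverge _       _       = ⊤

  δ-diverge : (s t : List (Fin q)) → Diverge s t → δ s t ≡ length s + length t
  δ-diverge []      t       _   = refl
  δ-diverge (x ∷ s) []      _   = cong suc (sym (+-identityʳ (length s)))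
  δ-diverge (x ∷ s) (y ∷ t) x≢y with x ≟ y
  ... | yes x≡y = ⊥-elim (x≢y x≡y)
  ... | no  _   = refl

  length-∷ʳ : (s : List (Fin q)) (a : Fin q) → length (s ∷ʳ a) ≡ suc (length s)
  length-∷ʳ s a = trans (length-++ s) (+-comm (length s) 1)

  δ-extend-≤ : (s : List (Fin q)) (a : Fin q) (t : List (Fin q)) → δ (s ∷ʳ a) t ≤ suc (δ s t)
  δ-extend-≤ []      a []      = ≤-refl
  δ-extend-≤ []      a (y ∷ t) with a ≟ y
  ... | yes _ = ≤-trans (n≤1+n _) (n≤1+n _)
  ... | no  _ = ≤-refl
  δ-extend-≤ (x ∷ s) a []      rewrite length-∷ʳ s a = ≤-refl
  δ-extend-≤ (x ∷ s) a (y ∷ t) with x ≟ y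
  ... | yes _ = δ-extend-≤ s a t
  ... | no  _ rewrite length-∷ʳ s a = ≤-refl

  δ-extend-≥ : (s : List (Fin q)) (a : Fin q) (t : List (Fin q)) → δ s t ≤ suc (δ (s ∷ʳ a) t)
  δ-extend-≥ []      a []      = z≤n
  δ-extend-≥ []      a (y ∷ t) with a ≟ y
  ... | yes _ = ≤-refl
  ... | no  _ = ≤-trans (n≤1+n _) (n≤1+n _)
  δ-extend-≥ (x ∷ s) a []      rewrite length-∷ʳ s a = ≤-trans (n≤1+n _) (n≤1+n _)
  δ-extend-≥ (x ∷ s) a (y ∷ t) with x ≟ y
  ... | yes _ = δ-extend-≥ s a t
  ... | no  _ rewrite length-∷ʳ s a = ≤-trans (n≤1+n _) (n≤1+n _)

  treeDist : Vertex q → Vertex q → ℕ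
  treeDist u v = δ (reverse (word u)) (reverse (word v))

  treeDist-adjacent : (w : Vertex q) {u v : Vertex q} → Adj u v → treeDist u w ≤ suc (treeDist v w)
  treeDist-adjacent w {u} {v} (inj₁ (a , v≡au)) =
    subst (λ r → treeDist u w ≤ suc (δ r (reverse (word w))))
          (sym (trans (cong reverse v≡au) (unfold-reverse a (word u))))
          (δ-extend-≥ (reverse (word u)) a (reverse (word w)))
  treeDist-adjacent w {u} {v} (inj₂ (a , u≡av)) =
    subst (λ r → δ r (reverse (word w)) ≤ suc (treeDist v w))
          (sym (trans (cong reverse u≡av) (unfold-reverse a (word v))))
          (δ-extend-≤ (reverse (word v)) a (reverse (word w)))

  treeDist-≤-walk : {u v : Vertex q} {n : ℕ} → Walk u v n → treeDist u v ≤ n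
  treeDist-≤-walk {u} {v} {n} W =
    subst (treeDist u v ≤_) (trans (cong (n +_) (δ-self (reverse (word v)))) (+-identityʳ n))
          (walk-potential (λ x → treeDist x v) (λ {x} {y} → treeDist-adjacent v {x} {y}) W)

  branch-distance : (p s t : List (Fin q)) (u v : Vertex q)
                  → word u ≡ reverse (p ++ s) → word v ≡ reverse (p ++ t)
                  → Diverge s t → Dist u v (length s + length t)
  branch-distance p s t u v u≡ps v≡pt st = walk , minimal
    where
      fork : Vertex q
      fork = reverse p , reduced-suffix (reverse s) (reverse p)
               (subst Reduced (trans u≡ps (reverse-++ p s)) (proj₂ u))

      ascend-from : (x : Vertex q) (r : List (Fin q)) → word x ≡ reverse (p ++ r) → Walk x fork (length r)
      ascend-from x r x≡pr = subst (Walk x fork) (length-reverse r)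
        (ascend (reverse r) x fork (trans x≡pr (reverse-++ p r)))

      walk : Walk u v (length s + length t)
      walk = ascend-from u s u≡ps ++ʷ reverseʷ (ascend-from v t v≡pt)

      root-first : (x : Vertex q) (r : List (Fin q)) → word x ≡ reverse (p ++ r) → reverse (word x) ≡ p ++ r
      root-first x r x≡pr = trans (cong reverse x≡pr) (reverse-involutive (p ++ r))

      treeDist-uv : treeDist u v ≡ length s + length t
      treeDist-uv = begin
        treeDist u v                 ≡⟨ cong₂ δ (root-first u s u≡ps) (root-first v t v≡pt) ⟩
        δ (p ++ s) (p ++ t)          ≡⟨ δ-common-prefix p s t ⟩
        δ s t                        ≡⟨ δ-diverge s t st ⟩
        length s + length t          ∎
        where open ≡-Reasoning

      minimal : ∀ m → m < length s + length t → ¬ Walk u v m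
      minimal m m<st W = <-irrefl refl (≤-trans m<st (subst (_≤ m) treeDist-uv (treeDist-≤-walk W)))

shared-colour : {A : Set} {k m : ℕ} → k ≤ suc m → (c : A → Fin k) (x y : A) (z : Fin m → A)
              → (∀ i → c x ≢ c (z i)) → (∀ i → c y ≢ c (z i))
              → (∀ i j → i ≢ j → c (z i) ≢ c (z j)) → c x ≡ c y
shared-colour {A} {k} {m} k≤ c x y z x≢z y≢z rainbow with c x ≟ c y
... | yes cx≡cy = cx≡cy
... | no  cx≢cy = ⊥-elim (injective (proj₂ (proj₂ (pigeonhole (s≤s k≤) colours))))
  where
    family : Fin (suc (suc m)) → A
    family zero          = x
    family (suc zero)    = y
    family (suc (suc i)) = z i

    colours : Fin (suc (suc m)) → Fin k
    colours i = c (family i)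

    injective : ∀ {i j} → i <ᶠ j × colours i ≡ colours j → ⊥
    injective {zero}        {suc zero}    (_ , e)                = cx≢cy e
    injective {zero}        {suc (suc j)} (_ , e)                = x≢z j e
    injective {suc zero}    {suc (suc j)} (_ , e)                = y≢z j e
    injective {suc (suc i)} {suc (suc j)} (s≤s (s≤s i<j) , e)    = rainbow i j (<⇒≢ i<j) e
    injective {_}           {zero}        (() , _)
    injective {suc zero}    {suc zero}    (s≤s () , _)
    injective {suc (suc i)} {suc zero}    (s≤s () , _)

split-0+4 : ∀ n → n + suc (suc (suc (suc n))) ≡ 2 * suc (suc n)
split-0+4 = solve-∀

split-1+3 : ∀ n → suc n + suc (suc (suc n)) ≡ 2 * suc (suc n)
split-1+3 = solve-∀

split-2+2 : ∀ n → suc (suc n) + suc (suc n) ≡ 2 * suc (suc n)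
split-2+2 = solve-∀

module Configuration (q' n : ℕ) where

  Q : ℕ
  Q = suc (suc (suc q'))

  d : ℕ
  d = 2 * suc (suc n)

  Letter : Set
  Letter = Fin Q

  ℓ₀ ℓ₁ ℓ₂ : Letter
  ℓ₀ = zero
  ℓ₁ = suc zero
  ℓ₂ = suc (suc zero)

  alternate : ℕ → Letter → Letter → List Letter
  alternate zero    x y = []
  alternate (suc m) x y = x ∷ alternate m y x

  length-alternate : ∀ m x y → length (alternate m x y) ≡ m
  length-alternate zero    x y = refl
  length-alternate (suc m) x y = cong suc (length-alternate m y x)

  reduced-alternate : ∀ m {x y z} → x ≢ y → z ≢ x → Reduced (z ∷ alternate m x y)
  reduced-alternate zero    x≢y z≢x = tt
  reduced-alternate (suc m) x≢y z≢x = cons-reduced z≢x (reduced-alternate m (≢-sym x≢y) x≢y)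

  node : (r : List Letter) → Reduced r → Vertex Q
  node r red = reverse r , reduced-reverse r red

  centrePath : List Letter
  centrePath = alternate n ℓ₂ ℓ₀

  centre : Vertex Q
  centre = node centrePath (reduced n)
    where
      reduced : ∀ m → Reduced (alternate m ℓ₂ ℓ₀)
      reduced zero    = tt
      reduced (suc m) = reduced-alternate m (λ ()) (λ ())

  module Flower (e f : Letter) (e≢f : e ≢ f) (e≢ℓ₂ : e ≢ ℓ₂) (f≢ℓ₂ : f ≢ ℓ₂) where

    twinPath : List Letter
    twinPath = e ∷ ℓ₂ ∷ alternate n f e

    twin : Vertex Q
    twin = node twinPath (cons-reduced e≢ℓ₂ (reduced-alternate n (≢-sym e≢f) (≢-sym f≢ℓ₂)))

    petalPath : Letter → List Letter
    petalPath a = e ∷ f ∷ a ∷ alternate (suc n) f e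

    petal : (a : Letter) → a ≢ f → Vertex Q
    petal a a≢f = node (petalPath a)
      (cons-reduced e≢f (cons-reduced (≢-sym a≢f) (reduced-alternate (suc n) (≢-sym e≢f) a≢f)))

    centre-petal : ∀ a a≢f → Dist centre (petal a a≢f) d
    centre-petal a a≢f = subst (Dist _ _) lengths
      (branch-distance [] centrePath (petalPath a) centre (petal a a≢f) refl refl (diverge n))
      where
        diverge : ∀ m → Diverge (alternate m ℓ₂ ℓ₀) (petalPath a)
        diverge zero    = tt
        diverge (suc m) = ≢-sym e≢ℓ₂

        lengths : length centrePath + length (petalPath a) ≡ d
        lengths rewrite length-alternate n ℓ₂ ℓ₀ | length-alternate n e f = split-0+4 n

    twin-petal : ∀ a a≢f → Dist twin (petal a a≢f) d
    twin-petal a a≢f = subst (Dist _ _) lengths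
      (branch-distance (e ∷ []) (ℓ₂ ∷ alternate n f e) (f ∷ a ∷ alternate (suc n) f e)
        twin (petal a a≢f) refl refl (≢-sym f≢ℓ₂))
      where
        lengths : length (ℓ₂ ∷ alternate n f e) + length (f ∷ a ∷ alternate (suc n) f e) ≡ d
        lengths rewrite length-alternate n f e | length-alternate n e f = split-1+3 n

    petal-petal : ∀ a a≢f b b≢f → a ≢ b → Dist (petal a a≢f) (petal b b≢f) d
    petal-petal a a≢f b b≢f a≢b = subst (Dist _ _) lengths
      (branch-distance (e ∷ f ∷ []) (a ∷ alternate (suc n) f e) (b ∷ alternate (suc n) f e)
        (petal a a≢f) (petal b b≢f) refl refl a≢b)
      where
        lengths : length (a ∷ alternate (suc n) f e) + length (b ∷ alternate (suc n) f e) ≡ d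
        lengths rewrite length-alternate n e f = split-2+2 n

    -- With at most q colours the twin must repeat the colour of the centre:
    -- the q − 1 petals (indexed by the letters punchIn f i ≠ f) form a
    -- rainbow family at distance d from both.
    twin-centre-colour : (k : ℕ) (c : Vertex Q → Fin k) → DistColouring Q d k c → k ≤ Q
                       → c centre ≡ c twin
    twin-centre-colour k c proper k≤Q =
      shared-colour k≤Q c centre twin petalOf
        (λ i → proper _ _ (centre-petal (letter i) (avoids i)))
        (λ i → proper _ _ (twin-petal (letter i) (avoids i)))
        (λ i j i≢j → proper _ _
          (petal-petal (letter i) (avoids i) (letter j) (avoids j) (i≢j ∘′ punchIn-injective f i j)))
      where
        letter : Fin (suc (suc q')) → Letter
        letter = punchIn f

        avoids : ∀ i → letter i ≢ f
        avoids = punchInᵢ≢i f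

        petalOf : Fin (suc (suc q')) → Vertex Q
        petalOf i = petal (letter i) (avoids i)

  module F₀₁ = Flower ℓ₀ ℓ₁ (λ ()) (λ ()) (λ ())
  module F₁₀ = Flower ℓ₁ ℓ₀ (λ ()) (λ ()) (λ ())

  twin-twin : Dist F₀₁.twin F₁₀.twin d
  twin-twin = subst (Dist _ _) lengths
    (branch-distance [] F₀₁.twinPath F₁₀.twinPath F₀₁.twin F₁₀.twin refl refl (λ ()))
    where
      lengths : length F₀₁.twinPath + length F₁₀.twinPath ≡ d
      lengths rewrite length-alternate n ℓ₁ ℓ₀ | length-alternate n ℓ₀ ℓ₁ = split-2+2 n

  -- Both twins share the colour of the centre, yet lie at distance d.
  few-colours-impossible : (k : ℕ) (c : Vertex Q → Fin k) → DistColouring Q d k c → ¬ k ≤ Q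
  few-colours-impossible k c proper k≤Q = proper _ _ twin-twin
    (trans (sym (F₀₁.twin-centre-colour k c proper k≤Q)) (F₁₀.twin-centre-colour k c proper k≤Q))

mainTheorem13 : (q d : ℕ) → 3 ≤ q → 4 ≤ d → (∃[ m ] d ≡ 2 * m)
    → (k : ℕ) (c : Vertex q → Fin k) → DistColouring q d k c → q + 1 ≤ k
mainTheorem13 q _ (s≤s (s≤s (s≤s {n = q'} _))) _ (suc (suc n) , refl) k c proper =
  subst (_≤ k) (+-comm 1 q) (≰⇒> (Configuration.few-colours-impossible q' n k c proper))
mainTheorem13 _ _ _ (s≤s (s≤s ())) (suc zero , refl) _ _ _
mainTheorem13 _ _ _ ()             (zero , refl)     _ _ _
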